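{- Let $s$ be a positive integer and let $G=(V,E)$ be a finite simple undirected graph. Suppose $V$ is partitioned into pairwise disjoint sets $V_1,\dots,V_k$ (so $V=V_1\cup\dots\cup V_k$) such that each induced subgraph $G[V_i]$, $1\le i\le k$, is an $s$-component. Then for every $S\subseteq V$ such that $G[S]$ is an $s$-bundle, we have $|S\cap V_i|\le \min\{|V_i|,s\}$ for every $i$, and consequently $$|S|\le PUB(G,s):=\sum_{i=1}^k \min\{|V_i|,s\}.$$ In particular, $\sum_{i=1}^k \min\{|V_i|,s\}$ is an upper bound on the number of vertices of a maximum $s$-bundle in $G$.
   Context: For a graph $H$, the (vertex) connectivity $\kappa(H)$ is the minimum number of vertices whose removal yields a disconnected graph or a trivial graph with at most one vertex. For $S\subseteq V$, $G[S]$ denotes the subgraph of $G$ induced by $S$. Given a positive integer $s$, a graph $H=(W,F)$ is an $s$-bundle if $\kappa(H)\ge |W|-s$; we say $S\subseteq V$ induces an $s$-bundle if $G[S]$ is an $s$-bundle. An $s$-component is a graph whose largest connected subgraph (equivalently, largest connected component) contains at most $s$ vertices. -}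

module Defs where

open import Data.Nat using (ℕ; _≤_; _∸_; _⊓_)
open import Data.Fin using (Fin)
open import Data.Fin.Subset using (Subset; _∈_; _⊆_; _∩_; _─_; ∣_∣)
open import Data.List using (List; map; allFin)
open import Data.Nat.ListAction using (sum)
open import Data.Sum using (_⊎_)
open import Data.Product using (_×_; Σ)
open import Data.Empty renaming (⊥ to Empty)
open import Relation.Nullary using (¬_)
open import Relation.Binary.PropositionalEquality using (_≡_)

record SimpleGraph (n : ℕ) : Set₁ where
  field
    Adj     : Fin n → Fin n → Set
    sym     : ∀ {u v} → Adj u v → Adj v u
    irrefl  : ∀ {u} → ¬ Adj u u
open SimpleGraph public

-- Walks in G that stay inside the vertex set W (i.e. walks in G[W]).
data Walk {n : ℕ} (G : SimpleGraph n) (W : Subset n) : Fin n → Fin n → Set where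
  here : ∀ {u} → u ∈ W → Walk G W u u
  step : ∀ {u w v} → u ∈ W → Adj G u w → Walk G W w v → Walk G W u v

Connected : ∀ {n} → SimpleGraph n → Subset n → Set
Connected G W = ∀ u v → u ∈ W → v ∈ W → Walk G W u v

DisconnectedOrTrivial : ∀ {n} → SimpleGraph n → Subset n → Set
DisconnectedOrTrivial G W = (¬ Connected G W) ⊎ (∣ W ∣ ≤ 1)

-- κ(G[S]) ≥ m : every vertex set T ⊆ S whose removal from G[S] leaves a
-- disconnected or trivial graph has at least m vertices
-- (κ is the minimum of |T| over such T; such T always exists, e.g. T = S).
ConnectivityAtLeast : ∀ {n} → SimpleGraph n → Subset n → ℕ → Set
ConnectivityAtLeast {n} G S m =
  ∀ (T : Subset n) → T ⊆ S → DisconnectedOrTrivial G (S ─ T) → m ≤ ∣ T ∣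

-- S induces an s-bundle: κ(G[S]) ≥ |S| − s  (truncated subtraction is harmless
-- since κ ≥ 0).
IsSBundle : ∀ {n} → SimpleGraph n → ℕ → Subset n → Set
IsSBundle G s S = ConnectivityAtLeast G S (∣ S ∣ ∸ s)

-- G[W] is an s-component: every connected subgraph of G[W] has at most s
-- vertices (the vertex set of a connected subgraph induces a connected graph).
IsSComponent : ∀ {n} → SimpleGraph n → ℕ → Subset n → Set
IsSComponent {n} G s W = ∀ (T : Subset n) → T ⊆ W → Connected G T → ∣ T ∣ ≤ s

-- P : Fin k → Subset n is a partition of the vertex set into V₁ … V_k
-- (pairwise disjoint, union is everything; parts may be empty).
IsPartition : ∀ {n k} → (Fin k → Subset n) → Set
IsPartition {n} {k} P =
  (∀ i j → ¬ (i ≡ j) → ∀ (v : Fin n) → v ∈ P i → v ∈ P j → Empty)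
  × (∀ (v : Fin n) → Σ (Fin k) (λ i → v ∈ P i))

PUB : ∀ {n k} → (Fin k → Subset n) → ℕ → ℕ
PUB {n} {k} P s = sum (map (λ i → ∣ P i ∣ ⊓ s) (allFin k))

-- If G[S ∩ Vᵢ] is connected it lies inside the s-component G[Vᵢ], so it has
-- at most s vertices. Otherwise deleting S ∖ Vᵢ disconnects the s-bundle G[S],
-- so |S| − s ≤ |S ∖ Vᵢ|, which again says |S ∩ Vᵢ| ≤ s. Since the Vᵢ cover S,
-- summing these bounds over i bounds |S|.
module Submission where

open import Defs hiding (sym)
open import Data.Nat using (ℕ; _≤_; _⊓_; _+_; _∸_; suc; z≤n; s≤s; _≤?_)
open import Data.Nat.Properties
  using (≤-trans; ≤-reflexive; +-suc; +-mono-≤; +-monoʳ-≤; +-cancelˡ-≤; m≤n+m; m≤n+m∸n; +-comm; ⊓-glb; module ≤-Reasoning)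
open import Data.Nat.ListAction using (sum)
open import Data.Fin using (Fin)
open import Data.Fin.Subset using (Subset; _∩_; _∪_; _─_; ⋃; ∣_∣; _⊆_; inside; outside)
  renaming (_∈_ to _∈ₛ_)
open import Data.Fin.Subset.Properties using (∣⊥∣≡0; p⊆q⇒∣p∣≤∣q∣; ∣p∩q∣≤∣q∣; p∩q⊆q; p─q⊆p; x∈p∩q⁺; x∈p∪q⁺)
open import Data.List using (List; []; _∷_; map; allFin)
open import Data.List.Properties using (map-∘)
open import Data.List.Membership.Propositional using (_∈_)
open import Data.List.Membership.Propositional.Properties using (∈-allFin; ∈-map⁺)
open import Data.List.Relation.Unary.Any using (here; there)
open import Data.Vec using (_∷_; [])
open import Data.Product using (_×_; _,_; Σ)
open import Data.Sum using (inj₁; inj₂)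
open import Relation.Nullary.Decidable using (decidable-stable)
open import Relation.Binary.PropositionalEquality using (_≡_; refl; cong; sym; subst)

private
  variable
    n : ℕ

p─[p─q]≡p∩q : ∀ (p q : Subset n) → p ─ (p ─ q) ≡ p ∩ q
p─[p─q]≡p∩q []            []            = refl
p─[p─q]≡p∩q (outside ∷ p) (outside ∷ q) = cong (outside ∷_) (p─[p─q]≡p∩q p q)
p─[p─q]≡p∩q (outside ∷ p) (inside  ∷ q) = cong (outside ∷_) (p─[p─q]≡p∩q p q)
p─[p─q]≡p∩q (inside  ∷ p) (outside ∷ q) = cong (outside ∷_) (p─[p─q]≡p∩q p q)
p─[p─q]≡p∩q (inside  ∷ p) (inside  ∷ q) = cong (inside ∷_) (p─[p─q]≡p∩q p q)

∣p─q∣+∣p∩q∣≡∣p∣ : ∀ (p q : Subset n) → ∣ p ─ q ∣ + ∣ p ∩ q ∣ ≡ ∣ p ∣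
∣p─q∣+∣p∩q∣≡∣p∣ []            []            = refl
∣p─q∣+∣p∩q∣≡∣p∣ (outside ∷ p) (outside ∷ q) = ∣p─q∣+∣p∩q∣≡∣p∣ p q
∣p─q∣+∣p∩q∣≡∣p∣ (outside ∷ p) (inside  ∷ q) = ∣p─q∣+∣p∩q∣≡∣p∣ p q
∣p─q∣+∣p∩q∣≡∣p∣ (inside  ∷ p) (outside ∷ q) = cong suc (∣p─q∣+∣p∩q∣≡∣p∣ p q)
∣p─q∣+∣p∩q∣≡∣p∣ (inside  ∷ p) (inside  ∷ q) =
  subst (_≡ suc ∣ p ∣) (sym (+-suc ∣ p ─ q ∣ ∣ p ∩ q ∣)) (cong suc (∣p─q∣+∣p∩q∣≡∣p∣ p q))

∣p∪q∣≤∣p∣+∣q∣ : ∀ (p q : Subset n) → ∣ p ∪ q ∣ ≤ ∣ p ∣ + ∣ q ∣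
∣p∪q∣≤∣p∣+∣q∣ []            []            = z≤n
∣p∪q∣≤∣p∣+∣q∣ (outside ∷ p) (outside ∷ q) = ∣p∪q∣≤∣p∣+∣q∣ p q
∣p∪q∣≤∣p∣+∣q∣ (outside ∷ p) (inside  ∷ q) =
  ≤-trans (s≤s (∣p∪q∣≤∣p∣+∣q∣ p q)) (≤-reflexive (sym (+-suc ∣ p ∣ ∣ q ∣)))
∣p∪q∣≤∣p∣+∣q∣ (inside  ∷ p) (outside ∷ q) = s≤s (∣p∪q∣≤∣p∣+∣q∣ p q)
∣p∪q∣≤∣p∣+∣q∣ (inside  ∷ p) (inside  ∷ q) =
  s≤s (≤-trans (∣p∪q∣≤∣p∣+∣q∣ p q) (+-monoʳ-≤ ∣ p ∣ (m≤n+m ∣ q ∣ 1)))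

x∈⋃⁺ : ∀ {x : Fin n} {p ps} → p ∈ ps → x ∈ₛ p → x ∈ₛ ⋃ ps
x∈⋃⁺ (here refl)  x∈p = x∈p∪q⁺ (inj₁ x∈p)
x∈⋃⁺ (there p∈ps) x∈p = x∈p∪q⁺ (inj₂ (x∈⋃⁺ p∈ps x∈p))

∣⋃ps∣≤sum∣ps∣ : ∀ (ps : List (Subset n)) → ∣ ⋃ ps ∣ ≤ sum (map ∣_∣ ps)
∣⋃ps∣≤sum∣ps∣ {n} []       = ≤-reflexive (∣⊥∣≡0 n)
∣⋃ps∣≤sum∣ps∣     (p ∷ ps) = ≤-trans (∣p∪q∣≤∣p∣+∣q∣ p (⋃ ps)) (+-monoʳ-≤ ∣ p ∣ (∣⋃ps∣≤sum∣ps∣ ps))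

∣p∣≤sum∣p∩Pᵢ∣ : ∀ {k} (p : Subset n) (P : Fin k → Subset n) →
  (∀ {x} → x ∈ₛ p → Σ (Fin k) (λ i → x ∈ₛ P i)) →
  ∣ p ∣ ≤ sum (map (λ i → ∣ p ∩ P i ∣) (allFin k))
∣p∣≤sum∣p∩Pᵢ∣ {k = k} p P cover = begin
  ∣ p ∣                            ≤⟨ p⊆q⇒∣p∣≤∣q∣ p⊆⋃parts ⟩
  ∣ ⋃ parts ∣                      ≤⟨ ∣⋃ps∣≤sum∣ps∣ parts ⟩
  sum (map ∣_∣ parts)              ≡⟨ cong sum (sym (map-∘ (allFin k))) ⟩
  sum (map (λ i → ∣ p ∩ P i ∣) (allFin k)) ∎
  where
  open ≤-Reasoning
  parts : List (Subset _)
  parts = map (λ i → p ∩ P i) (allFin k)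
  p⊆⋃parts : p ⊆ ⋃ parts
  p⊆⋃parts x∈p with cover x∈p
  ... | i , x∈Pᵢ = x∈⋃⁺ (∈-map⁺ (λ i → p ∩ P i) (∈-allFin i)) (x∈p∩q⁺ (x∈p , x∈Pᵢ))

sum-map-mono : ∀ {A : Set} {f g : A → ℕ} → (∀ x → f x ≤ g x) →
  ∀ xs → sum (map f xs) ≤ sum (map g xs)
sum-map-mono f≤g []       = z≤n
sum-map-mono f≤g (x ∷ xs) = +-mono-≤ (f≤g x) (sum-map-mono f≤g xs)

m+n∸o≤m⇒n≤o : ∀ m n o → m + n ∸ o ≤ m → n ≤ o
m+n∸o≤m⇒n≤o m n o m+n∸o≤m = +-cancelˡ-≤ m n o (begin
  m + n           ≤⟨ m≤n+m∸n (m + n) o ⟩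
  o + (m + n ∸ o) ≤⟨ +-monoʳ-≤ o m+n∸o≤m ⟩
  o + m           ≡⟨ +-comm o m ⟩
  m + o           ∎)
  where open ≤-Reasoning

module _ {G : SimpleGraph n} {s : ℕ} {S : Subset n} (bundle : IsSBundle G s S) where

  IsSBundle⇒disconnected-part≤s : ∀ W → DisconnectedOrTrivial G (S ∩ W) → ∣ S ∩ W ∣ ≤ s
  IsSBundle⇒disconnected-part≤s W disconnected = m+n∸o≤m⇒n≤o ∣ S ─ W ∣ ∣ S ∩ W ∣ s
    (subst (λ m → m ∸ s ≤ ∣ S ─ W ∣) (sym (∣p─q∣+∣p∩q∣≡∣p∣ S W))
      (bundle (S ─ W) (p─q⊆p S W) (subst (DisconnectedOrTrivial G) (sym (p─[p─q]≡p∩q S W)) disconnected)))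

  -- G[S ∩ W] is connected or not; the case split is licensed by stability of _≤_.
  IsSBundle⇒∣S∩W∣≤s : ∀ {W} → IsSComponent G s W → ∣ S ∩ W ∣ ≤ s
  IsSBundle⇒∣S∩W∣≤s {W} component = decidable-stable (∣ S ∩ W ∣ ≤? s) λ ∣S∩W∣≰s →
    ∣S∩W∣≰s (IsSBundle⇒disconnected-part≤s W
      (inj₁ λ connected → ∣S∩W∣≰s (component (S ∩ W) (p∩q⊆q S W) connected)))

lemma3 : (s : ℕ) → 1 ≤ s → (n : ℕ) → (G : SimpleGraph n) →
    (k : ℕ) → (P : Fin k → Subset n) → IsPartition P →
    (∀ i → IsSComponent G s (P i)) →
    (S : Subset n) → IsSBundle G s S →
    (∀ i → ∣ S ∩ P i ∣ ≤ ∣ P i ∣ ⊓ s) × (∣ S ∣ ≤ PUB P s)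
lemma3 s _ n G k P (_ , covering) components S bundle = part-bound , total-bound
  where
  part-bound : ∀ i → ∣ S ∩ P i ∣ ≤ ∣ P i ∣ ⊓ s
  part-bound i = ⊓-glb (∣p∩q∣≤∣q∣ S (P i)) (IsSBundle⇒∣S∩W∣≤s bundle (components i))

  total-bound : ∣ S ∣ ≤ PUB P s
  total-bound = ≤-trans (∣p∣≤sum∣p∩Pᵢ∣ S P (λ {x} _ → covering x)) (sum-map-mono part-bound (allFin k))
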